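{- Let $p$ be a prime, $k\ge 1$, and let $\varphi\in\mathbb{Z}[x]$ be a monic polynomial that is irreducible modulo $p$. Let $f(x),h(x)\in\mathbb{Z}[x]$ satisfy $f\equiv \varphi^e+p\,l \bmod p^k$ and $h\equiv \varphi^a-p\,y\bmod p^k$, where $l,y\in(\mathbb{Z}/\langle p^k\rangle)[x]$ and $a\le e$ are nonnegative integers. Then $h$ divides $f$ modulo $p^k$ (i.e. $f\equiv hg\bmod p^k$ for some $g\in(\mathbb{Z}/\langle p^k\rangle)[x]$) if and only if $$E(y):=f(x)\left(\varphi^{a(k-1)}+\varphi^{a(k-2)}(py)+\cdots+\varphi^{a}(py)^{k-2}+(py)^{k-1}\right)\equiv 0\bmod \langle p^k,\varphi^{ak}\rangle,$$ where $\langle p^k,\varphi^{ak}\rangle$ denotes the ideal of $\mathbb{Z}[x]$ generated by $p^k$ and $\varphi^{ak}$. -}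

module Defs where

open import Data.Nat as ℕ using (ℕ; zero; suc; _∸_; _<_)
open import Data.Integer as ℤ using (ℤ; +_; 0ℤ; 1ℤ)
open import Data.Integer.Divisibility using () renaming (_∣_ to _∣ℤ_)
open import Data.List using (List; []; _∷_; map; foldr; upTo)
open import Data.Product using (∃; ∃-syntax; _×_)
open import Data.Sum using (_⊎_)
open import Relation.Binary.PropositionalEquality using (_≡_)
open import Relation.Nullary using (¬_)
open import Data.Nat.Divisibility using () renaming (_∣_ to _∣ℕ_)

-- Polynomials in ℤ[x] as coefficient lists, lowest degree first.
-- (Trailing zeros allowed; all comparisons are made coefficient-wise.)
Poly : Set
Poly = List ℤ

coeff : Poly → ℕ → ℤ
coeff []       _       = 0ℤ
coeff (c ∷ _)  zero    = c
coeff (_ ∷ cs) (suc n) = coeff cs n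

const : ℤ → Poly
const c = c ∷ []

zeroP : Poly
zeroP = []

oneP : Poly
oneP = 1ℤ ∷ []

infixl 6 _+P_ _-P_
infixl 7 _*P_ _·P_
infixr 8 _^P_

_+P_ : Poly → Poly → Poly
[]       +P q        = q
(a ∷ p)  +P []       = a ∷ p
(a ∷ p)  +P (b ∷ q)  = (a ℤ.+ b) ∷ (p +P q)

_·P_ : ℤ → Poly → Poly
c ·P p = map (c ℤ.*_) p

negP : Poly → Poly
negP p = map ℤ.-_ p

_-P_ : Poly → Poly → Poly
p -P q = p +P negP q

_*P_ : Poly → Poly → Poly
[]      *P q = []
(a ∷ p) *P q = (a ·P q) +P (0ℤ ∷ (p *P q))

_^P_ : Poly → ℕ → Poly
p ^P zero  = oneP
p ^P suc n = p *P (p ^P n)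

sumP : List Poly → Poly
sumP = foldr _+P_ zeroP

_≈P_ : Poly → Poly → Set
f ≈P g = ∀ n → coeff f n ≡ coeff g n

_≡P_[mod_] : Poly → Poly → ℕ → Set
f ≡P g [mod m ] = ∀ n → (+ m) ∣ℤ (coeff f n ℤ.- coeff g n)

Monic : Poly → Set
Monic φ = ∃[ d ] (coeff φ d ≡ 1ℤ × (∀ n → d < n → coeff φ n ≡ 0ℤ))

-- Units of 𝔽_p[x] (p prime): nonzero constants mod p.
UnitMod : ℕ → Poly → Set
UnitMod p g = ∃[ c ] (¬ ((+ p) ∣ℤ c) × g ≡P const c [mod p ])

IrreducibleMod : ℕ → Poly → Set
IrreducibleMod p φ =
  ¬ (φ ≡P zeroP [mod p ]) × ¬ UnitMod p φ ×
  (∀ g h → φ ≡P g *P h [mod p ] → UnitMod p g ⊎ UnitMod p h)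

InIdeal₂ : ℕ → Poly → Poly → Set
InIdeal₂ m q E = ∃[ u ] ∃[ v ] (E ≈P ((+ m) ·P u +P q *P v))

Eexpr : ℕ → ℕ → ℕ → Poly → Poly → Poly → Poly
Eexpr p k a φ f y =
  f *P sumP (map (λ i → (φ ^P (a ℕ.* (k ∸ 1 ∸ i))) *P (((+ p) ·P y) ^P i)) (upTo k))

module Submission where

-- Write A = φ^a, B = p·y and S = Σ_{i<k} φ^{a(k-1-i)} B^i, so that E(y) = f·S.
-- The telescoping identity (A − B)·S = φ^{ak} − B^k together with B^k = p^k y^k
-- shows that S inverts h modulo ⟨p^k, φ^{ak}⟩:  h·S ≡ φ^{ak} (mod p^k).
--   (⇒) If f ≡ h·g then f·S ≡ φ^{ak}·g (mod p^k), which puts f·S in the ideal.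
--   (⇐) If f·S = p^k·u + φ^{ak}·v then (f − h·v)·S ≡ 0 (mod p^k).  Since 𝔽_p[x] has
--       no zero divisors and S ≡ φ^{a(k-1)} ≢ 0 (mod p), a p-adic lifting argument
--       cancels S and yields f ≡ h·v (mod p^k).
-- Only the facts "p prime", "k ≥ 1", "φ ≢ 0 mod p" (part of irreducibility) and the
-- congruence for h are needed; the remaining hypotheses of the theorem are unused.

open import Defs
open import Data.Nat as ℕ using (ℕ; zero; suc; _≤_; _^_; _*_; _∸_; NonZero; s≤s)
open import Data.Nat.Properties as ℕP using ()
import Data.Nat.Divisibility as ℕ∣
open import Data.Nat.Primality using (Prime; euclidsLemma; prime⇒nonZero; ¬prime[1])
open import Data.Integer as ℤ using (ℤ; +_; 0ℤ; 1ℤ; -_)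
open import Data.Integer.Properties as ℤP using ()
open import Data.Integer.Divisibility.Signed as ℤ∣ using (_∣_; divides; _∣?_; ∣ᵤ⇒∣; ∣⇒∣ᵤ)
import Data.Integer.Solver
open import Data.List using ([]; _∷_; map; upTo; applyUpTo)
open import Data.List.Properties using (map-upTo)
open import Data.Maybe using (Maybe; just; nothing)
open import Data.Product using (Σ; ∃-syntax; _,_; proj₁; proj₂)
open import Data.Sum as Sum using (_⊎_; inj₁; inj₂)
open import Function using (_∘_)
open import Function.Bundles using (_⇔_; mk⇔)
open import Relation.Nullary using (¬_; yes; no; contradiction)
open import Relation.Binary.PropositionalEquality
  using (_≡_; refl; sym; trans; cong; cong₂; subst; subst₂)
open import Relation.Binary.Structures using (IsEquivalence)
open import Algebra.Bundles using (CommutativeRing)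
open import Level using (0ℓ)
import Algebra.Solver.Ring
import Relation.Binary.Reasoning.Setoid as SetoidReasoning
open import Algebra.Solver.Ring.AlmostCommutativeRing
  using (fromCommutativeRing; _-Raw-AlmostCommutative⟶_)

-- _≈P_ packaged as a record, so that both polynomials can be inferred.
infix 4 _≃_
record _≃_ (f g : Poly) : Set where
  constructor coeffwise
  field at : f ≈P g
open _≃_

≃-refl : ∀ {f} → f ≃ f
≃-refl = coeffwise λ _ → refl

≃-reflexive : ∀ {f g} → f ≡ g → f ≃ g
≃-reflexive refl = ≃-refl

≃-sym : ∀ {f g} → f ≃ g → g ≃ f
≃-sym e = coeffwise λ n → sym (at e n)

≃-trans : ∀ {f g h} → f ≃ g → g ≃ h → f ≃ h
≃-trans e e′ = coeffwise λ n → trans (at e n) (at e′ n)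

≃-isEquivalence : IsEquivalence _≃_
≃-isEquivalence = record { refl = ≃-refl ; sym = ≃-sym ; trans = ≃-trans }

shift : Poly → Poly
shift f = 0ℤ ∷ f

coeff-+P : ∀ f g n → coeff (f +P g) n ≡ coeff f n ℤ.+ coeff g n
coeff-+P []      g       n       = sym (ℤP.+-identityˡ _)
coeff-+P (a ∷ f) []      n       = sym (ℤP.+-identityʳ _)
coeff-+P (a ∷ f) (b ∷ g) zero    = refl
coeff-+P (a ∷ f) (b ∷ g) (suc n) = coeff-+P f g n

coeff-·P : ∀ c f n → coeff (c ·P f) n ≡ c ℤ.* coeff f n
coeff-·P c []      n       = sym (ℤP.*-zeroʳ c)
coeff-·P c (a ∷ f) zero    = refl
coeff-·P c (a ∷ f) (suc n) = coeff-·P c f n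

coeff-negP : ∀ f n → coeff (negP f) n ≡ - coeff f n
coeff-negP []      n       = refl
coeff-negP (a ∷ f) zero    = refl
coeff-negP (a ∷ f) (suc n) = coeff-negP f n

coeff--P : ∀ f g n → coeff (f -P g) n ≡ coeff f n ℤ.- coeff g n
coeff--P f g n = trans (coeff-+P f (negP g) n) (cong (λ z → coeff f n ℤ.+ z) (coeff-negP g n))

coeff-*P : ∀ a f g n → coeff ((a ∷ f) *P g) n ≡ a ℤ.* coeff g n ℤ.+ coeff (shift (f *P g)) n
coeff-*P a f g n = trans (coeff-+P (a ·P g) (shift (f *P g)) n)
                         (cong (ℤ._+ coeff (shift (f *P g)) n) (coeff-·P a g n))

-- Poly is a commutative ring up to ≃

+P-cong : ∀ {f f′ g g′} → f ≃ f′ → g ≃ g′ → f +P g ≃ f′ +P g′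
+P-cong {f} {f′} {g} {g′} e e′ = coeffwise λ n →
  trans (coeff-+P f g n) (trans (cong₂ ℤ._+_ (at e n) (at e′ n)) (sym (coeff-+P f′ g′ n)))

+P-congˡ : ∀ f {g g′} → g ≃ g′ → f +P g ≃ f +P g′
+P-congˡ f = +P-cong (≃-refl {f})

+P-congʳ : ∀ g {f f′} → f ≃ f′ → f +P g ≃ f′ +P g
+P-congʳ g e = +P-cong e (≃-refl {g})

·P-cong : ∀ c {f f′} → f ≃ f′ → c ·P f ≃ c ·P f′
·P-cong c {f} {f′} e = coeffwise λ n →
  trans (coeff-·P c f n) (trans (cong (c ℤ.*_) (at e n)) (sym (coeff-·P c f′ n)))

negP-cong : ∀ {f f′} → f ≃ f′ → negP f ≃ negP f′
negP-cong {f} {f′} e = coeffwise λ n →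
  trans (coeff-negP f n) (trans (cong -_ (at e n)) (sym (coeff-negP f′ n)))

shift-cong : ∀ {f f′} → f ≃ f′ → shift f ≃ shift f′
shift-cong e = coeffwise λ { zero → refl ; (suc n) → at e n }

shift-[] : shift [] ≃ []
shift-[] = coeffwise λ { zero → refl ; (suc n) → refl }

shift-+P : ∀ f g → shift (f +P g) ≃ shift f +P shift g
shift-+P f g = coeffwise λ { zero → refl ; (suc n) → refl }

vanishing-*P : ∀ f g → f ≃ [] → f *P g ≃ []
vanishing-*P []      g e = ≃-refl
vanishing-*P (a ∷ f) g e =
  +P-cong (coeffwise λ n → trans (coeff-·P a g n) (cong (ℤ._* coeff g n) (at e 0)))
          (≃-trans (shift-cong (vanishing-*P f g (coeffwise (at e ∘ suc)))) shift-[])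

*P-congʳ : ∀ f {g g′} → g ≃ g′ → f *P g ≃ f *P g′
*P-congʳ []      e = ≃-refl
*P-congʳ (a ∷ f) e = +P-cong (·P-cong a e) (shift-cong (*P-congʳ f e))

*P-congˡ : ∀ {f f′} g → f ≃ f′ → f *P g ≃ f′ *P g
*P-congˡ {[]}    {[]}     g e = ≃-refl
*P-congˡ {[]}    {a ∷ f′} g e = ≃-sym (vanishing-*P (a ∷ f′) g (≃-sym e))
*P-congˡ {a ∷ f} {[]}     g e = vanishing-*P (a ∷ f) g e
*P-congˡ {a ∷ f} {a′ ∷ f′} g e =
  +P-cong (≃-reflexive (cong (_·P g) (at e 0)))
          (shift-cong (*P-congˡ {f} {f′} g (coeffwise (at e ∘ suc))))

*P-cong : ∀ {f f′ g g′} → f ≃ f′ → g ≃ g′ → f *P g ≃ f′ *P g′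
*P-cong {f′ = f′} {g} e e′ = ≃-trans (*P-congˡ g e) (*P-congʳ f′ e′)

+P-comm : ∀ f g → f +P g ≃ g +P f
+P-comm f g = coeffwise λ n →
  trans (coeff-+P f g n) (trans (ℤP.+-comm (coeff f n) (coeff g n)) (sym (coeff-+P g f n)))

+P-assoc : ∀ f g h → (f +P g) +P h ≃ f +P (g +P h)
+P-assoc f g h = coeffwise λ n → begin
  coeff ((f +P g) +P h) n                 ≡⟨ coeff-+P (f +P g) h n ⟩
  coeff (f +P g) n ℤ.+ coeff h n          ≡⟨ cong (ℤ._+ coeff h n) (coeff-+P f g n) ⟩
  coeff f n ℤ.+ coeff g n ℤ.+ coeff h n   ≡⟨ ℤP.+-assoc (coeff f n) (coeff g n) (coeff h n) ⟩
  coeff f n ℤ.+ (coeff g n ℤ.+ coeff h n) ≡⟨ cong (λ z → coeff f n ℤ.+ z) (coeff-+P g h n) ⟨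
  coeff f n ℤ.+ coeff (g +P h) n          ≡⟨ coeff-+P f (g +P h) n ⟨
  coeff (f +P (g +P h)) n                 ∎
  where open Relation.Binary.PropositionalEquality.≡-Reasoning

+P-identityʳ : ∀ f → f +P [] ≃ f
+P-identityʳ f = coeffwise λ n → trans (coeff-+P f [] n) (ℤP.+-identityʳ _)

+P-inverseˡ : ∀ f → negP f +P f ≃ []
+P-inverseˡ f = coeffwise λ n → trans (coeff-+P (negP f) f n)
  (trans (cong (ℤ._+ coeff f n) (coeff-negP f n)) (ℤP.+-inverseˡ (coeff f n)))

+P-inverseʳ : ∀ f → f +P negP f ≃ []
+P-inverseʳ f = ≃-trans (+P-comm f (negP f)) (+P-inverseˡ f)

*P-distribʳ : ∀ f f′ g → (f +P f′) *P g ≃ f *P g +P f′ *P g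
*P-distribʳ []      f′       g = ≃-refl
*P-distribʳ (a ∷ f) []       g = ≃-sym (+P-identityʳ _)
*P-distribʳ (a ∷ f) (b ∷ f′) g = coeffwise λ n → begin
  coeff (((a ℤ.+ b) ∷ (f +P f′)) *P g) n
    ≡⟨ coeff-*P (a ℤ.+ b) (f +P f′) g n ⟩
  (a ℤ.+ b) ℤ.* coeff g n ℤ.+ coeff (shift ((f +P f′) *P g)) n
    ≡⟨ cong (λ z → (a ℤ.+ b) ℤ.* coeff g n ℤ.+ z) (trans (at shifted n) (coeff-+P (shift (f *P g)) (shift (f′ *P g)) n)) ⟩
  (a ℤ.+ b) ℤ.* coeff g n ℤ.+ (coeff (shift (f *P g)) n ℤ.+ coeff (shift (f′ *P g)) n)
    ≡⟨ solve 5 (λ a b c x y → (a :+ b) :* c :+ (x :+ y) := (a :* c :+ x) :+ (b :* c :+ y))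
             refl a b (coeff g n) _ _ ⟩
  (a ℤ.* coeff g n ℤ.+ coeff (shift (f *P g)) n) ℤ.+ (b ℤ.* coeff g n ℤ.+ coeff (shift (f′ *P g)) n)
    ≡⟨ cong₂ ℤ._+_ (coeff-*P a f g n) (coeff-*P b f′ g n) ⟨
  coeff ((a ∷ f) *P g) n ℤ.+ coeff ((b ∷ f′) *P g) n
    ≡⟨ coeff-+P ((a ∷ f) *P g) ((b ∷ f′) *P g) n ⟨
  coeff ((a ∷ f) *P g +P (b ∷ f′) *P g) n ∎
  where
  open Relation.Binary.PropositionalEquality.≡-Reasoning
  open Data.Integer.Solver.+-*-Solver
  shifted : shift ((f +P f′) *P g) ≃ shift (f *P g) +P shift (f′ *P g)
  shifted = ≃-trans (shift-cong (*P-distribʳ f f′ g)) (shift-+P (f *P g) (f′ *P g))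

*P-distribˡ : ∀ f g g′ → f *P (g +P g′) ≃ f *P g +P f *P g′
*P-distribˡ []      g g′ = ≃-refl
*P-distribˡ (a ∷ f) g g′ = coeffwise λ n → begin
  coeff ((a ∷ f) *P (g +P g′)) n
    ≡⟨ coeff-*P a f (g +P g′) n ⟩
  a ℤ.* coeff (g +P g′) n ℤ.+ coeff (shift (f *P (g +P g′))) n
    ≡⟨ cong₂ (λ u v → a ℤ.* u ℤ.+ v) (coeff-+P g g′ n)
                                   (trans (at shifted n) (coeff-+P (shift (f *P g)) (shift (f *P g′)) n)) ⟩
  a ℤ.* (coeff g n ℤ.+ coeff g′ n) ℤ.+ (coeff (shift (f *P g)) n ℤ.+ coeff (shift (f *P g′)) n)
    ≡⟨ solve 5 (λ a u v x y → a :* (u :+ v) :+ (x :+ y) := (a :* u :+ x) :+ (a :* v :+ y))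
             refl a (coeff g n) (coeff g′ n) _ _ ⟩
  (a ℤ.* coeff g n ℤ.+ coeff (shift (f *P g)) n) ℤ.+ (a ℤ.* coeff g′ n ℤ.+ coeff (shift (f *P g′)) n)
    ≡⟨ cong₂ ℤ._+_ (coeff-*P a f g n) (coeff-*P a f g′ n) ⟨
  coeff ((a ∷ f) *P g) n ℤ.+ coeff ((a ∷ f) *P g′) n
    ≡⟨ coeff-+P ((a ∷ f) *P g) ((a ∷ f) *P g′) n ⟨
  coeff ((a ∷ f) *P g +P (a ∷ f) *P g′) n ∎
  where
  open Relation.Binary.PropositionalEquality.≡-Reasoning
  open Data.Integer.Solver.+-*-Solver
  shifted : shift (f *P (g +P g′)) ≃ shift (f *P g) +P shift (f *P g′)
  shifted = ≃-trans (shift-cong (*P-distribˡ f g g′)) (shift-+P (f *P g) (f *P g′))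

*P-zeroʳ : ∀ f → f *P [] ≃ []
*P-zeroʳ []      = ≃-refl
*P-zeroʳ (a ∷ f) = ≃-trans (shift-cong (*P-zeroʳ f)) shift-[]

*P-shiftʳ : ∀ f g → f *P shift g ≃ shift (f *P g)
*P-shiftʳ []      g = ≃-sym shift-[]
*P-shiftʳ (a ∷ f) g = coeffwise λ
  { zero    → trans (ℤP.+-identityʳ _) (ℤP.*-zeroʳ a)
  ; (suc n) → at (+P-congˡ (a ·P g) (*P-shiftʳ f g)) n }

*P-shiftˡ : ∀ f g → shift f *P g ≃ shift (f *P g)
*P-shiftˡ f g = +P-congʳ (shift (f *P g)) {0ℤ ·P g} {[]} (coeffwise (coeff-·P 0ℤ g))

*P-constʳ : ∀ f c → f *P const c ≃ c ·P f
*P-constʳ []      c = ≃-refl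
*P-constʳ (b ∷ f) c = coeffwise λ
  { zero    → trans (ℤP.+-identityʳ _) (ℤP.*-comm b c)
  ; (suc n) → at (*P-constʳ f c) n }

const+shift : ∀ a f → const a +P shift f ≃ a ∷ f
const+shift a f = coeffwise λ { zero → ℤP.+-identityʳ a ; (suc n) → refl }

*P-comm : ∀ f g → f *P g ≃ g *P f
*P-comm []      g = ≃-sym (*P-zeroʳ g)
*P-comm (a ∷ f) g =
  ≃-trans (+P-cong (≃-sym (*P-constʳ g a))
                   (≃-trans (shift-cong (*P-comm f g)) (≃-sym (*P-shiftʳ g f))))
  (≃-trans (≃-sym (*P-distribˡ g (const a) (shift f))) (*P-congʳ g (const+shift a f)))

·P-*Pˡ : ∀ c f g → (c ·P f) *P g ≃ c ·P (f *P g)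
·P-*Pˡ c []      g = ≃-refl
·P-*Pˡ c (a ∷ f) g = coeffwise λ n → begin
  coeff ((c ·P (a ∷ f)) *P g) n
    ≡⟨ coeff-*P (c ℤ.* a) (c ·P f) g n ⟩
  c ℤ.* a ℤ.* coeff g n ℤ.+ coeff (shift ((c ·P f) *P g)) n
    ≡⟨ cong (λ z → c ℤ.* a ℤ.* coeff g n ℤ.+ z) (trans (at (≃-trans (shift-cong (·P-*Pˡ c f g)) scaled) n)
                                                      (coeff-·P c (shift (f *P g)) n)) ⟩
  c ℤ.* a ℤ.* coeff g n ℤ.+ c ℤ.* coeff (shift (f *P g)) n
    ≡⟨ solve 4 (λ c a u x → c :* a :* u :+ c :* x := c :* (a :* u :+ x))
             refl c a (coeff g n) _ ⟩
  c ℤ.* (a ℤ.* coeff g n ℤ.+ coeff (shift (f *P g)) n)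
    ≡⟨ cong (c ℤ.*_) (coeff-*P a f g n) ⟨
  c ℤ.* coeff ((a ∷ f) *P g) n
    ≡⟨ coeff-·P c ((a ∷ f) *P g) n ⟨
  coeff (c ·P ((a ∷ f) *P g)) n ∎
  where
  open Relation.Binary.PropositionalEquality.≡-Reasoning
  open Data.Integer.Solver.+-*-Solver
  scaled : shift (c ·P (f *P g)) ≃ c ·P shift (f *P g)
  scaled = coeffwise λ { zero → sym (ℤP.*-zeroʳ c) ; (suc n) → refl }

·P-*Pʳ : ∀ c f g → f *P (c ·P g) ≃ c ·P (f *P g)
·P-*Pʳ c f g = ≃-trans (*P-comm f (c ·P g)) (≃-trans (·P-*Pˡ c g f) (·P-cong c (*P-comm g f)))

·P-·P : ∀ c d f → c ·P (d ·P f) ≃ (c ℤ.* d) ·P f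
·P-·P c d f = coeffwise λ n → begin
  coeff (c ·P (d ·P f)) n      ≡⟨ coeff-·P c (d ·P f) n ⟩
  c ℤ.* coeff (d ·P f) n       ≡⟨ cong (c ℤ.*_) (coeff-·P d f n) ⟩
  c ℤ.* (d ℤ.* coeff f n)      ≡⟨ ℤP.*-assoc c d (coeff f n) ⟨
  c ℤ.* d ℤ.* coeff f n        ≡⟨ coeff-·P (c ℤ.* d) f n ⟨
  coeff ((c ℤ.* d) ·P f) n     ∎
  where open Relation.Binary.PropositionalEquality.≡-Reasoning

*P-assoc : ∀ f g h → (f *P g) *P h ≃ f *P (g *P h)
*P-assoc []      g h = ≃-refl
*P-assoc (a ∷ f) g h =
  ≃-trans (*P-distribʳ (a ·P g) (shift (f *P g)) h)
          (+P-cong (·P-*Pˡ a g h) (≃-trans (*P-shiftˡ (f *P g) h) (shift-cong (*P-assoc f g h))))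

*P-identityˡ : ∀ f → oneP *P f ≃ f
*P-identityˡ f = coeffwise λ n → trans (coeff-*P 1ℤ [] f n)
  (trans (cong₂ ℤ._+_ (ℤP.*-identityˡ (coeff f n)) (at shift-[] n)) (ℤP.+-identityʳ _))

*P-identityʳ : ∀ f → f *P oneP ≃ f
*P-identityʳ f = ≃-trans (*P-comm f oneP) (*P-identityˡ f)

polyCommutativeRing : CommutativeRing 0ℓ 0ℓ
polyCommutativeRing = record
  { Carrier = Poly ; _≈_ = _≃_ ; _+_ = _+P_ ; _*_ = _*P_ ; -_ = negP ; 0# = [] ; 1# = oneP
  ; isCommutativeRing = record
    { isRing = record
      { +-isAbelianGroup = record
        { isGroup = record
          { isMonoid = record
            { isSemigroup = record
              { isMagma = record { isEquivalence = ≃-isEquivalence ; ∙-cong = +P-cong }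
              ; assoc = +P-assoc }
            ; identity = (λ _ → ≃-refl) , +P-identityʳ }
          ; inverse = +P-inverseˡ , +P-inverseʳ
          ; ⁻¹-cong = negP-cong }
        ; comm = +P-comm }
      ; *-cong = *P-cong
      ; *-assoc = *P-assoc
      ; *-identity = *P-identityˡ , *P-identityʳ
      ; distrib = *P-distribˡ , (λ g f f′ → *P-distribʳ f f′ g) }
    ; *-comm = *P-comm } }

module ≃-Reasoning = SetoidReasoning (CommutativeRing.setoid polyCommutativeRing)

module PolySolver where
  private
    constants : CommutativeRing.rawRing ℤP.+-*-commutativeRing
                  -Raw-AlmostCommutative⟶ fromCommutativeRing polyCommutativeRing
    constants = record
      { ⟦_⟧    = const
      ; +-homo = λ _ _ → ≃-refl
      ; *-homo = λ c d → coeffwise λ { zero → sym (ℤP.+-identityʳ _) ; (suc n) → refl }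
      ; -‿homo = λ _ → ≃-refl
      ; 0-homo = coeffwise λ { zero → refl ; (suc n) → refl }
      ; 1-homo = ≃-refl }

    const-≟ : ∀ a b → Maybe (const a ≃ const b)
    const-≟ a b with a ℤ.≟ b
    ... | yes refl = just ≃-refl
    ... | no _     = nothing

  open Algebra.Solver.Ring _ (fromCommutativeRing polyCommutativeRing) constants const-≟ public

pow-+ : ∀ φ m n → φ ^P (m ℕ.+ n) ≃ (φ ^P m) *P (φ ^P n)
pow-+ φ zero    n = ≃-sym (*P-identityˡ _)
pow-+ φ (suc m) n = ≃-trans (*P-congʳ φ (pow-+ φ m n)) (≃-sym (*P-assoc φ (φ ^P m) (φ ^P n)))

·P-^P : ∀ c f k → (+ c ·P f) ^P k ≃ + (c ^ k) ·P (f ^P k)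
·P-^P c f zero    = coeffwise λ { zero → refl ; (suc n) → refl }
·P-^P c f (suc k) =
  ≃-trans (*P-congʳ (+ c ·P f) (·P-^P c f k))
  (≃-trans (·P-*Pˡ (+ c) f _)
  (≃-trans (·P-cong (+ c) (·P-*Pʳ (+ (c ^ k)) f (f ^P k)))
  (≃-trans (·P-·P (+ c) (+ (c ^ k)) _)
           (≃-reflexive (cong (_·P (f *P (f ^P k))) (sym (ℤP.pos-* c (c ^ k))))))))

-- Divisibility of all coefficients by an integer

infix 4 _∣ₚ_
record _∣ₚ_ (m : ℕ) (D : Poly) : Set where
  constructor coeffs-divisible
  field divides-at : ∀ n → + m ∣ coeff D n
open _∣ₚ_

0-divisible : ∀ m → + m ∣ 0ℤ
0-divisible m = divides 0ℤ refl

∣ₚ-resp : ∀ {m D D′} → D ≃ D′ → m ∣ₚ D → m ∣ₚ D′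
∣ₚ-resp e d = coeffs-divisible λ n → subst (_ ∣_) (at e n) (divides-at d n)

1∣ₚ : ∀ D → 1 ∣ₚ D
1∣ₚ D = coeffs-divisible λ n → divides (coeff D n) (sym (ℤP.*-identityʳ _))

∣ₚ-+P : ∀ {m D E} → m ∣ₚ D → m ∣ₚ E → m ∣ₚ D +P E
∣ₚ-+P {D = D} {E} d e = coeffs-divisible λ n →
  subst (_ ∣_) (sym (coeff-+P D E n)) (ℤ∣.∣m∣n⇒∣m+n (divides-at d n) (divides-at e n))

∣ₚ-negP : ∀ {m D} → m ∣ₚ D → m ∣ₚ negP D
∣ₚ-negP {D = D} d = coeffs-divisible λ n →
  subst (_ ∣_) (sym (coeff-negP D n)) (ℤ∣.∣m⇒∣-m (divides-at d n))

∣ₚ-cancel-+P : ∀ {m D E} → m ∣ₚ D +P E → m ∣ₚ D → m ∣ₚ E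
∣ₚ-cancel-+P {D = D} {E} d+e d = coeffs-divisible λ n →
  ℤ∣.∣m+n∣m⇒∣n (subst (_ ∣_) (coeff-+P D E n) (divides-at d+e n)) (divides-at d n)

∣ₚ-shift : ∀ {m D} → m ∣ₚ D → m ∣ₚ shift D
∣ₚ-shift {m} d = coeffs-divisible λ { zero → 0-divisible m ; (suc n) → divides-at d n }

∣ₚ-unshift : ∀ {m d D} → m ∣ₚ d ∷ D → m ∣ₚ D
∣ₚ-unshift d = coeffs-divisible (divides-at d ∘ suc)

∣ₚ-·P : ∀ {m c} W → + m ∣ c → m ∣ₚ c ·P W
∣ₚ-·P {c = c} W m∣c = coeffs-divisible λ n →
  subst (_ ∣_) (sym (coeff-·P c W n)) (ℤ∣.∣m⇒∣m*n (coeff W n) m∣c)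

∣ₚ-*Pˡ : ∀ {m} D Q → m ∣ₚ D → m ∣ₚ D *P Q
∣ₚ-*Pˡ {m} []      Q d = coeffs-divisible λ _ → 0-divisible m
∣ₚ-*Pˡ     (a ∷ D) Q d = ∣ₚ-+P (∣ₚ-·P Q (divides-at d 0)) (∣ₚ-shift (∣ₚ-*Pˡ D Q (∣ₚ-unshift d)))

∣ₚ-quotient : ∀ {m} D → m ∣ₚ D → Σ Poly λ Q → D ≃ + m ·P Q
∣ₚ-quotient []      _ = [] , ≃-refl
∣ₚ-quotient {m} (a ∷ D) d with ∣ₚ-quotient D (∣ₚ-unshift d) | divides-at d 0
... | Q , D≃mQ | divides q a≡qm = (q ∷ Q) , coeffwise λ
  { zero → trans a≡qm (ℤP.*-comm q (+ m)) ; (suc n) → at D≃mQ n }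

≡P⇒∣ₚ : ∀ {m} f g → f ≡P g [mod m ] → m ∣ₚ f -P g
≡P⇒∣ₚ f g f≡g = coeffs-divisible λ n → subst (_ ∣_) (sym (coeff--P f g n)) (∣ᵤ⇒∣ (f≡g n))

∣ₚ⇒≡P : ∀ {m} f g → m ∣ₚ f -P g → f ≡P g [mod m ]
∣ₚ⇒≡P f g d n = ∣⇒∣ᵤ (subst (_ ∣_) (coeff--P f g n) (divides-at d n))

scaled-modulus : ∀ m c → + (m * c) ≡ + c ℤ.* + m
scaled-modulus m c = trans (ℤP.pos-* m c) (ℤP.*-comm (+ m) (+ c))

∣ₚ-scale : ∀ c {m D} → m ∣ₚ D → m * c ∣ₚ (+ c) ·P D
∣ₚ-scale c {m} {D} d = coeffs-divisible λ n →
  subst₂ _∣_ (sym (scaled-modulus m c)) (sym (coeff-·P (+ c) D n)) (ℤ∣.*-monoʳ-∣ (+ c) (divides-at d n))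

∣ₚ-unscale : ∀ c {m D} .{{_ : NonZero c}} → m * c ∣ₚ (+ c) ·P D → m ∣ₚ D
∣ₚ-unscale c {m} {D} d = coeffs-divisible λ n →
  ℤ∣.*-cancelˡ-∣ (+ c) (subst₂ _∣_ (scaled-modulus m c) (coeff-·P (+ c) D n) (divides-at d n))

∣ₚ-weaken : ∀ c {m D} → c * m ∣ₚ D → m ∣ₚ D
∣ₚ-weaken c d = coeffs-divisible λ n → ℤ∣.∣-trans (∣ᵤ⇒∣ (ℕ∣.n∣m*n c)) (divides-at d n)

-- 𝔽_p[x] has no zero divisors, and its consequence modulo p^k

euclid-ℤ : ∀ {p} → Prime p → ∀ x s → + p ∣ x ℤ.* s → + p ∣ x ⊎ + p ∣ s
euclid-ℤ pp x s p∣xs =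
  Sum.map ∣ᵤ⇒∣ ∣ᵤ⇒∣ (euclidsLemma ℤ.∣ x ∣ ℤ.∣ s ∣ pp (subst (_ ℕ∣.∣_) (ℤP.abs-* x s) (∣⇒∣ᵤ p∣xs)))

-- If p ∤ s, then p ∣ X·(s + x·S) forces p ∣ X: the lowest coefficient x₀ of X
-- satisfies p ∣ x₀·s, hence p ∣ x₀, and x₀·(s + x·S) can be removed.
prime-cancel-unit : ∀ {p} → Prime p → ∀ {s S} → ¬ (+ p ∣ s) → ∀ X → p ∣ₚ X *P (s ∷ S) → p ∣ₚ X
prime-cancel-unit {p} pp p∤s []      _    = coeffs-divisible λ _ → 0-divisible p
prime-cancel-unit {p} pp {s} {S} p∤s (x ∷ X) p∣xXS =
  coeffs-divisible λ { zero → p∣x ; (suc n) → divides-at p∣X n }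
  where
  p∣x : + p ∣ x
  p∣x with euclid-ℤ pp x s (subst (_ ∣_) (ℤP.+-identityʳ _) (divides-at p∣xXS 0))
  ... | inj₁ p∣x = p∣x
  ... | inj₂ p∣s = contradiction p∣s p∤s
  p∣X : p ∣ₚ X
  p∣X = prime-cancel-unit pp p∤s X (∣ₚ-unshift (∣ₚ-cancel-+P p∣xXS (∣ₚ-·P (s ∷ S) p∣x)))

-- Cancellation in 𝔽_p[x]: if S ≢ 0 (mod p) and p ∣ X·S then p ∣ X.  Leading
-- coefficients of S divisible by p are stripped until one is a unit mod p.
prime-cancel : ∀ {p} → Prime p → ∀ S → ¬ (p ∣ₚ S) → ∀ X → p ∣ₚ X *P S → p ∣ₚ X
prime-cancel {p} pp []      p∤S X _ = contradiction (coeffs-divisible λ _ → 0-divisible p) p∤S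
prime-cancel {p} pp (s ∷ S) p∤sS X p∣XsS with + p ∣? s
... | no  p∤s = prime-cancel-unit pp p∤s X p∣XsS
... | yes p∣s = prime-cancel pp S p∤S X p∣XS
  where
  p∤S : ¬ (p ∣ₚ S)
  p∤S p∣S = p∤sS (coeffs-divisible λ { zero → p∣s ; (suc n) → divides-at p∣S n })
  split : X *P (s ∷ S) ≃ s ·P X +P shift (X *P S)
  split = ≃-trans (*P-congʳ X (≃-sym (const+shift s S)))
          (≃-trans (*P-distribˡ X (const s) (shift S)) (+P-cong (*P-constʳ X s) (*P-shiftʳ X S)))
  p∣XS : p ∣ₚ X *P S
  p∣XS = ∣ₚ-unshift (∣ₚ-cancel-+P (∣ₚ-resp split p∣XsS) (∣ₚ-·P X p∣s))

nonzero-^P : ∀ {p} → Prime p → ∀ {φ} → ¬ (p ∣ₚ φ) → ∀ N → ¬ (p ∣ₚ φ ^P N)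
nonzero-^P pp p∤φ zero    p∣1 = ¬prime[1] (subst Prime (ℕ∣.∣1⇒≡1 (∣⇒∣ᵤ (divides-at p∣1 0))) pp)
nonzero-^P pp {φ} p∤φ (suc N) p∣φφᴺ =
  nonzero-^P pp p∤φ N (prime-cancel pp φ p∤φ (φ ^P N) (∣ₚ-resp (*P-comm φ (φ ^P N)) p∣φφᴺ))

-- Lifting: if S ≢ 0 (mod p) and p^k ∣ D·S then p^k ∣ D.  Inductively D = p^k·Q, and
-- p^{k+1} ∣ p^k·(Q·S) gives p ∣ Q·S, hence p ∣ Q.
lift : ∀ {p} → Prime p → ∀ S → ¬ (p ∣ₚ S) → ∀ k D → p ^ k ∣ₚ D *P S → p ^ k ∣ₚ D
lift     pp S p∤S zero    D _ = 1∣ₚ D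
lift {p} pp S p∤S (suc k) D pᵏ⁺¹∣DS =
  ∣ₚ-resp (≃-sym D≃pᵏQ) (∣ₚ-scale (p ^ k) p∣Q)
  where
  instance
    p≢0 : NonZero p
    p≢0 = prime⇒nonZero pp
  quotient : Σ Poly λ Q → D ≃ (+ (p ^ k)) ·P Q
  quotient = ∣ₚ-quotient D (lift pp S p∤S k D (∣ₚ-weaken p pᵏ⁺¹∣DS))
  Q : Poly
  Q = proj₁ quotient
  D≃pᵏQ : D ≃ (+ (p ^ k)) ·P Q
  D≃pᵏQ = proj₂ quotient
  p∣QS : p ∣ₚ Q *P S
  p∣QS = ∣ₚ-unscale (p ^ k) {{ℕP.m^n≢0 p k}}
           (∣ₚ-resp (≃-trans (*P-congˡ S D≃pᵏQ) (·P-*Pˡ (+ (p ^ k)) Q S)) pᵏ⁺¹∣DS)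
  p∣Q : p ∣ₚ Q
  p∣Q = prime-cancel pp S p∤S Q p∣QS

-- The geometric sum

-- geomSum a φ B k = Σ_{i<k} φ^{a(k-1-i)} B^i, the quotient (A^k − B^k)/(A − B) for A = φ^a.
geomSum : ℕ → Poly → Poly → ℕ → Poly
geomSum a φ B k = sumP (map (λ i → (φ ^P (a * (k ∸ 1 ∸ i))) *P (B ^P i)) (upTo k))

sumP-factor : ∀ B (G F : ℕ → Poly) → (∀ i → G i ≃ B *P F i) →
              ∀ n → sumP (applyUpTo G n) ≃ B *P sumP (applyUpTo F n)
sumP-factor B G F G≃BF zero    = ≃-sym (*P-zeroʳ B)
sumP-factor B G F G≃BF (suc n) =
  ≃-trans (+P-cong (G≃BF 0) (sumP-factor B (G ∘ suc) (F ∘ suc) (G≃BF ∘ suc) n))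
          (≃-sym (*P-distribˡ B (F 0) _))

geomSum-suc : ∀ a φ B k → geomSum a φ B (suc k) ≃ φ ^P (a * k) +P B *P geomSum a φ B k
geomSum-suc a φ B k = begin
  geomSum a φ B (suc k)
    ≡⟨ cong sumP (map-upTo (term (suc k)) (suc k)) ⟩
  term (suc k) 0 +P sumP (applyUpTo (term (suc k) ∘ suc) k)
    ≈⟨ +P-cong (*P-identityʳ _) (sumP-factor B (term (suc k) ∘ suc) (term k) factor k) ⟩
  φ ^P (a * k) +P B *P sumP (applyUpTo (term k) k)
    ≡⟨ cong (λ s → φ ^P (a * k) +P B *P sumP s) (map-upTo (term k) k) ⟨
  φ ^P (a * k) +P B *P geomSum a φ B k ∎
  where
  open ≃-Reasoning
  open PolySolver
  term : ℕ → ℕ → Poly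
  term k i = (φ ^P (a * (k ∸ 1 ∸ i))) *P (B ^P i)
  factor : ∀ i → term (suc k) (suc i) ≃ B *P term k i
  factor i =
    ≃-trans (*P-congˡ (B *P (B ^P i))
              (≃-reflexive (cong (λ j → φ ^P (a * j)) (sym (ℕP.∸-+-assoc k 1 i)))))
            (solve 3 (λ X B Bⁱ → X :* (B :* Bⁱ) := B :* (X :* Bⁱ)) ≃-refl
                   (φ ^P (a * (k ∸ 1 ∸ i))) B (B ^P i))

geomSum-telescopes : ∀ a φ B k → (φ ^P a -P B) *P geomSum a φ B k ≃ φ ^P (a * k) -P B ^P k
geomSum-telescopes a φ B zero rewrite ℕP.*-zeroʳ a =
  ≃-trans (*P-zeroʳ (φ ^P a -P B)) (≃-sym (+P-inverseʳ oneP))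
geomSum-telescopes a φ B (suc k) = begin
  (A -P B) *P geomSum a φ B (suc k)
    ≈⟨ *P-congʳ (A -P B) (geomSum-suc a φ B k) ⟩
  (A -P B) *P (Φ +P B *P S)
    ≈⟨ solve 4 (λ A B Φ S → (A :- B) :* (Φ :+ B :* S) := A :* Φ :- B :* Φ :+ B :* ((A :- B) :* S))
             ≃-refl A B Φ S ⟩
  A *P Φ -P B *P Φ +P B *P ((A -P B) *P S)
    ≈⟨ +P-congˡ (A *P Φ -P B *P Φ) (*P-congʳ B (geomSum-telescopes a φ B k)) ⟩
  A *P Φ -P B *P Φ +P B *P (Φ -P B ^P k)
    ≈⟨ solve 4 (λ A B Φ Bᵏ → A :* Φ :- B :* Φ :+ B :* (Φ :- Bᵏ) := A :* Φ :- B :* Bᵏ)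
             ≃-refl A B Φ (B ^P k) ⟩
  A *P Φ -P B ^P suc k
    ≈⟨ +P-congʳ (negP (B ^P suc k)) A·Φ≃φ^a[k+1] ⟩
  φ ^P (a * suc k) -P B ^P suc k ∎
  where
  open ≃-Reasoning
  open PolySolver
  A Φ S : Poly
  A = φ ^P a
  Φ = φ ^P (a * k)
  S = geomSum a φ B k
  A·Φ≃φ^a[k+1] : A *P Φ ≃ φ ^P (a * suc k)
  A·Φ≃φ^a[k+1] = ≃-trans (≃-sym (pow-+ φ a (a * k))) (≃-reflexive (cong (φ ^P_) (sym (ℕP.*-suc a k))))

-- If h ≡ φ^a − p·y (mod p^k), then h·S_k ≡ φ^{ak} (mod p^k), because B^k = p^k·y^k.
geomSum-inverts : ∀ p k a φ h y → h ≡P φ ^P a -P (+ p) ·P y [mod p ^ k ] →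
                  p ^ k ∣ₚ h *P geomSum a φ ((+ p) ·P y) k -P φ ^P (a * k)
geomSum-inverts p k a φ h y h≡A-B =
  ∣ₚ-resp (≃-sym decomposition) (∣ₚ-+P (∣ₚ-*Pˡ _ S (≡P⇒∣ₚ h (A -P B) h≡A-B)) (∣ₚ-negP pᵏ∣Bᵏ))
  where
  open ≃-Reasoning
  open PolySolver
  A B S Φ : Poly
  A = φ ^P a
  B = (+ p) ·P y
  S = geomSum a φ B k
  Φ = φ ^P (a * k)
  pᵏ∣Bᵏ : p ^ k ∣ₚ B ^P k
  pᵏ∣Bᵏ = ∣ₚ-resp (≃-sym (·P-^P p y k)) (∣ₚ-·P (y ^P k) ℤ∣.∣-refl)
  decomposition : h *P S -P Φ ≃ (h -P (A -P B)) *P S +P negP (B ^P k)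
  decomposition = begin
    h *P S -P Φ
      ≈⟨ solve 4 (λ h D S Φ → h :* S :- Φ := (h :- D) :* S :+ (D :* S :- Φ)) ≃-refl h (A -P B) S Φ ⟩
    (h -P (A -P B)) *P S +P ((A -P B) *P S -P Φ)
      ≈⟨ +P-congˡ ((h -P (A -P B)) *P S) (+P-congʳ (negP Φ) (geomSum-telescopes a φ B k)) ⟩
    (h -P (A -P B)) *P S +P ((Φ -P B ^P k) -P Φ)
      ≈⟨ +P-congˡ ((h -P (A -P B)) *P S) (solve 2 (λ Φ Bᵏ → Φ :- Bᵏ :- Φ := :- Bᵏ) ≃-refl Φ (B ^P k)) ⟩
    (h -P (A -P B)) *P S +P negP (B ^P k) ∎

-- S_k ≡ φ^{a(k-1)} (mod p) for k ≥ 1, so S_k does not vanish mod p when φ does not.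
geomSum-nonzero : ∀ {p} → Prime p → ∀ a φ y k → ¬ (p ∣ₚ φ) → 1 ≤ k →
                  ¬ (p ∣ₚ geomSum a φ ((+ p) ·P y) k)
geomSum-nonzero {p} pp a φ y (suc k) p∤φ (s≤s _) p∣S = nonzero-^P pp p∤φ (a * k) p∣Φ
  where
  B = (+ p) ·P y
  p∣BS : p ∣ₚ B *P geomSum a φ B k
  p∣BS = ∣ₚ-resp (≃-sym (·P-*Pˡ (+ p) y _)) (∣ₚ-·P _ ℤ∣.∣-refl)
  p∣Φ : p ∣ₚ φ ^P (a * k)
  p∣Φ = ∣ₚ-cancel-+P (∣ₚ-resp (≃-trans (geomSum-suc a φ B k) (+P-comm (φ ^P (a * k)) (B *P geomSum a φ B k))) p∣S) p∣BS

factor⇒inIdeal : ∀ m f h g S Φ → m ∣ₚ h *P S -P Φ → f ≡P h *P g [mod m ] →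
                 InIdeal₂ m Φ (f *P S)
factor⇒inIdeal m f h g S Φ hS≡Φ f≡hg = proj₁ quotient , g , at fS≃mu+Φg
  where
  open ≃-Reasoning
  open PolySolver
  m∣fS-Φg : m ∣ₚ f *P S -P Φ *P g
  m∣fS-Φg = ∣ₚ-resp
    (≃-sym (solve 5 (λ f h g S Φ → f :* S :- Φ :* g := (f :- h :* g) :* S :+ (h :* S :- Φ) :* g)
                  ≃-refl f h g S Φ))
    (∣ₚ-+P (∣ₚ-*Pˡ _ S (≡P⇒∣ₚ f (h *P g) f≡hg)) (∣ₚ-*Pˡ _ g hS≡Φ))
  quotient : Σ Poly λ u → f *P S -P Φ *P g ≃ (+ m) ·P u
  quotient = ∣ₚ-quotient _ m∣fS-Φg
  fS≃mu+Φg : f *P S ≃ (+ m) ·P proj₁ quotient +P Φ *P g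
  fS≃mu+Φg = begin
    f *P S                          ≈⟨ solve 2 (λ E X → E := E :- X :+ X) ≃-refl (f *P S) (Φ *P g) ⟩
    f *P S -P Φ *P g +P Φ *P g      ≈⟨ +P-congʳ (Φ *P g) (proj₂ quotient) ⟩
    (+ m) ·P proj₁ quotient +P Φ *P g ∎

inIdeal⇒factor : ∀ m f h S Φ → m ∣ₚ h *P S -P Φ → InIdeal₂ m Φ (f *P S) →
                 ∃[ v ] (m ∣ₚ (f -P h *P v) *P S)
inIdeal⇒factor m f h S Φ hS≡Φ (u , v , fS≈mu+Φv) =
  v , ∣ₚ-resp (≃-sym decomposition) (∣ₚ-+P (∣ₚ-·P u ℤ∣.∣-refl) (∣ₚ-negP (∣ₚ-*Pˡ _ v hS≡Φ)))
  where
  open ≃-Reasoning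
  open PolySolver
  decomposition : (f -P h *P v) *P S ≃ (+ m) ·P u -P (h *P S -P Φ) *P v
  decomposition = begin
    (f -P h *P v) *P S
      ≈⟨ solve 5 (λ f h v S Φ → (f :- h :* v) :* S := f :* S :- Φ :* v :- (h :* S :- Φ) :* v)
               ≃-refl f h v S Φ ⟩
    f *P S -P Φ *P v -P (h *P S -P Φ) *P v
      ≈⟨ +P-congʳ (negP ((h *P S -P Φ) *P v)) (+P-congʳ (negP (Φ *P v)) (coeffwise fS≈mu+Φv)) ⟩
    (+ m) ·P u +P Φ *P v -P Φ *P v -P (h *P S -P Φ) *P v
      ≈⟨ solve 3 (λ U X Y → U :+ X :- X :- Y := U :- Y) ≃-refl ((+ m) ·P u) (Φ *P v) ((h *P S -P Φ) *P v) ⟩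
    (+ m) ·P u -P (h *P S -P Φ) *P v ∎

theorem3 : (p k a e : ℕ) (φ f h l y : Poly) → Prime p → 1 ≤ k → Monic φ → IrreducibleMod p φ → a ≤ e → f ≡P (φ ^P e) +P ((+ p) ·P l) [mod p ^ k ] → h ≡P (φ ^P a) -P ((+ p) ·P y) [mod p ^ k ] → ((∃[ g ] (f ≡P h *P g [mod p ^ k ])) ⇔ InIdeal₂ (p ^ k) (φ ^P (a * k)) (Eexpr p k a φ f y))
theorem3 p k a e φ f h l y p-prime 1≤k _ (φ≢0 , _) _ _ h≡φᵃ-py = mk⇔ forward backward
  where
  S : Poly
  S = geomSum a φ ((+ p) ·P y) k
  hS≡φᵃᵏ : p ^ k ∣ₚ h *P S -P φ ^P (a * k)
  hS≡φᵃᵏ = geomSum-inverts p k a φ h y h≡φᵃ-py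
  p∤S : ¬ (p ∣ₚ S)
  p∤S = geomSum-nonzero p-prime a φ y k
          (λ p∣φ → φ≢0 (∣ₚ⇒≡P φ zeroP (∣ₚ-resp (≃-sym (+P-identityʳ φ)) p∣φ))) 1≤k
  forward : ∃[ g ] (f ≡P h *P g [mod p ^ k ]) → InIdeal₂ (p ^ k) (φ ^P (a * k)) (f *P S)
  forward (g , f≡hg) = factor⇒inIdeal (p ^ k) f h g S (φ ^P (a * k)) hS≡φᵃᵏ f≡hg
  backward : InIdeal₂ (p ^ k) (φ ^P (a * k)) (f *P S) → ∃[ g ] (f ≡P h *P g [mod p ^ k ])
  backward fS∈ideal = cancelS (inIdeal⇒factor (p ^ k) f h S (φ ^P (a * k)) hS≡φᵃᵏ fS∈ideal)
    where
    cancelS : ∃[ v ] (p ^ k ∣ₚ (f -P h *P v) *P S) → ∃[ g ] (f ≡P h *P g [mod p ^ k ])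
    cancelS (v , pᵏ∣[f-hv]S) = v , ∣ₚ⇒≡P f (h *P v) (lift p-prime S p∤S k (f -P h *P v) pᵏ∣[f-hv]S)
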